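{- Let $n\ge2$ and let $i^\ast\ne j^\ast\in[n]$. Define $\mathsf{d}$ on $[n]$ by $\mathsf{d}(i,i)=0$, $\mathsf{d}(i,j)=1+\frac{|i-j|}{n-1}$ for distinct $i,j$ with $\{i,j\}\ne\{i^\ast,j^\ast\}$, and $\mathsf{d}(i^\ast,j^\ast)=\mathsf{d}(j^\ast,i^\ast)=1$ (this is a metric). Then there is a navigable graph on $([n],\mathsf{d})$ with maximum out-degree at most $3$.
   Context: A directed graph $G=(P,E)$ on a finite metric space $(P,\mathsf{d})$ is navigable if for every $s,t\in P$ with $\mathsf{d}(s,t)>0$ there is $u$ with $(s,u)\in E$ and $\mathsf{d}(u,t)<\mathsf{d}(s,t)$. -}

module Defs where

open import Data.Nat as ℕ using (ℕ; zero; suc; _≤_; s≤s; ∣_-_∣; _∸_)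
open import Data.Integer using (+_)
open import Data.Rational using (ℚ; 0ℚ; 1ℚ; _+_; _/_; _<_)
open import Data.Fin using (Fin; toℕ; _≟_)
open import Data.Fin.Subset using (Subset; _∈_; ∣_∣)
open import Data.Bool using (Bool; true; false; if_then_else_; _∧_; _∨_)
open import Data.Product using (∃; _×_)
open import Relation.Nullary.Decidable using (⌊_⌋)

-- |i - j| / (n - 1) as a rational, for n ≥ 2 (so that n - 1 ≠ 0).
ratio : (n : ℕ) → 2 ≤ n → ℕ → ℚ
ratio (suc (suc k)) (s≤s (s≤s _)) a = (+ a) / suc k

dist : (n : ℕ) → 2 ≤ n → (i* j* : Fin n) → Fin n → Fin n → ℚ
dist n h i* j* i j =
  if ⌊ i ≟ j ⌋ then 0ℚ
  else if (⌊ i ≟ i* ⌋ ∧ ⌊ j ≟ j* ⌋) ∨ (⌊ i ≟ j* ⌋ ∧ ⌊ j ≟ i* ⌋) then 1ℚ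
  else 1ℚ + ratio n h ∣ toℕ i - toℕ j ∣

Graph : ℕ → Set
Graph n = Fin n → Subset n

outDegree : ∀ {n} → Graph n → Fin n → ℕ
outDegree E s = ∣ E s ∣

Navigable : ∀ {n} → (Fin n → Fin n → ℚ) → Graph n → Set
Navigable {n} d E =
  (s t : Fin n) → 0ℚ < d s t → ∃ λ u → u ∈ E s × d u t < d s t

MaxOutDegreeAtMost : ∀ {n} → Graph n → ℕ → Set
MaxOutDegreeAtMost {n} E k = (s : Fin n) → outDegree E s ≤ k

-- Join consecutive vertices in both directions and add the edges i* → j*, j* → i*.
-- The special pair is then one hop apart.  For any other pair s ≠ t,
-- d(s,t) = 1 + |s − t|/(n − 1) while every distance is at most 1 + |u − t|/(n − 1),
-- so the path neighbour u of s on the side of t is strictly closer to t.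
module Submission where

open import Defs
open import Data.Nat using (ℕ; _≤_)
open import Data.Fin using (Fin)
open import Data.Product using (∃; _×_)
open import Relation.Binary.PropositionalEquality using (_≢_)

open import Data.Nat as ℕ using (zero; suc; z≤n; s≤s; ∣_-_∣)
import Data.Nat.Properties as ℕ
open import Data.Integer as ℤ using (+_)
import Data.Integer.Properties as ℤ
open import Data.Rational as ℚ using (ℚ; 0ℚ; 1ℚ; _+_; _/_; _<_)
import Data.Rational.Properties as ℚ
import Data.Rational.Unnormalised as ℚᵘ
import Data.Rational.Unnormalised.Properties as ℚᵘ
open import Data.Fin as Fin using (toℕ; _≟_; pred; fromℕ<)
import Data.Fin.Properties as Fin
open import Data.Fin.Subset using (Subset; _∈_; ∣_∣; ⁅_⁆; _∪_; inside; outside)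
open import Data.Fin.Subset.Properties using (x∈⁅x⁆; x∈p∪q⁺; ∣⁅x⁆∣≡1; ∣p∣≤∣x∷p∣)
open import Data.Bool using (Bool; true; false; if_then_else_; _∧_; _∨_)
open import Data.Product using (_,_)
open import Data.Sum using (_⊎_; inj₁; inj₂)
open import Data.Vec using ([]; _∷_)
open import Relation.Nullary using (¬_; Dec; yes; no; does; contradiction)
open import Relation.Nullary.Decidable using (⌊_⌋; _×-dec_; _⊎-dec_; isYes≗does; dec-true; dec-false)
open import Relation.Binary using (tri<; tri≈; tri>)
open import Relation.Binary.PropositionalEquality using (_≡_; refl; sym; trans; cong; cong₂; subst)

⌊⌋≡true : ∀ {a} {A : Set a} (a? : Dec A) → A → ⌊ a? ⌋ ≡ true
⌊⌋≡true a? a = trans (isYes≗does a?) (dec-true a? a)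

⌊⌋≡false : ∀ {a} {A : Set a} (a? : Dec A) → ¬ A → ⌊ a? ⌋ ≡ false
⌊⌋≡false a? ¬a = trans (isYes≗does a?) (dec-false a? ¬a)

∣1+m-n∣<∣m-n∣ : ∀ {m n} → m ℕ.< n → ∣ suc m - n ∣ ℕ.< ∣ m - n ∣
∣1+m-n∣<∣m-n∣ {zero}  {suc n} _         = ℕ.n<1+n n
∣1+m-n∣<∣m-n∣ {suc m} {suc n} (s≤s m<n) = ∣1+m-n∣<∣m-n∣ m<n

∣pred[m]-n∣<∣m-n∣ : ∀ {m n} → n ℕ.< m → ∣ ℕ.pred m - n ∣ ℕ.< ∣ m - n ∣
∣pred[m]-n∣<∣m-n∣ {suc zero}    {zero}  _             = s≤s z≤n
∣pred[m]-n∣<∣m-n∣ {suc zero}    {suc _} (s≤s ())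
∣pred[m]-n∣<∣m-n∣ {suc (suc m)} {zero}  _             = ℕ.n<1+n (suc m)
∣pred[m]-n∣<∣m-n∣ {suc (suc m)} {suc n} (s≤s n<1+m) = ∣pred[m]-n∣<∣m-n∣ {suc m} n<1+m

+m/n<+o/n : ∀ {m o} k → m ℕ.< o → + m / suc k < + o / suc k
+m/n<+o/n {m} {o} k m<o = ℚ.toℚᵘ-cancel-< (begin-strict
  ℚ.toℚᵘ (+ m / suc k)  ≃⟨ ℚ.toℚᵘ-fromℚᵘ (ℚᵘ.mkℚᵘ (+ m) k) ⟩
  ℚᵘ.mkℚᵘ (+ m) k       <⟨ ℚᵘ.*<* (ℤ.*-monoʳ-<-pos (+ suc k) (ℤ.+<+ m<o)) ⟩
  ℚᵘ.mkℚᵘ (+ o) k       ≃⟨ ℚ.toℚᵘ-fromℚᵘ (ℚᵘ.mkℚᵘ (+ o) k) ⟨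
  ℚ.toℚᵘ (+ o / suc k)  ∎)
  where open ℚᵘ.≤-Reasoning

p≤p+q : ∀ p {q} → 0ℚ ℚ.≤ q → p ℚ.≤ p + q
p≤p+q p 0≤q = subst (ℚ._≤ p + _) (ℚ.+-identityʳ p) (ℚ.+-monoʳ-≤ p 0≤q)

ratio-nonNeg : ∀ n h a → 0ℚ ℚ.≤ ratio n h a
ratio-nonNeg (suc (suc k)) (s≤s (s≤s _)) a =
  ℚ.nonNegative⁻¹ _ {{ℚ.normalize-nonNeg a (suc k)}}

ratio-mono-< : ∀ n h {a b} → a ℕ.< b → ratio n h a < ratio n h b
ratio-mono-< (suc (suc k)) (s≤s (s≤s _)) = +m/n<+o/n k

∣p∪q∣≤∣p∣+∣q∣ : ∀ {n} (p q : Subset n) → ∣ p ∪ q ∣ ≤ ∣ p ∣ ℕ.+ ∣ q ∣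
∣p∪q∣≤∣p∣+∣q∣ []            []            = z≤n
∣p∪q∣≤∣p∣+∣q∣ (inside ∷ p)  (x ∷ q)       =
  s≤s (ℕ.≤-trans (∣p∪q∣≤∣p∣+∣q∣ p q) (ℕ.+-monoʳ-≤ ∣ p ∣ (∣p∣≤∣x∷p∣ x q)))
∣p∪q∣≤∣p∣+∣q∣ (outside ∷ p) (inside ∷ q)  =
  subst (suc ∣ p ∪ q ∣ ≤_) (sym (ℕ.+-suc ∣ p ∣ ∣ q ∣)) (s≤s (∣p∪q∣≤∣p∣+∣q∣ p q))
∣p∪q∣≤∣p∣+∣q∣ (outside ∷ p) (outside ∷ q) = ∣p∪q∣≤∣p∣+∣q∣ p q

∣⁅x⁆∪⁅y⁆∪⁅z⁆∣≤3 : ∀ {n} (x y z : Fin n) → ∣ ⁅ x ⁆ ∪ ⁅ y ⁆ ∪ ⁅ z ⁆ ∣ ≤ 3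
∣⁅x⁆∪⁅y⁆∪⁅z⁆∣≤3 x y z = begin
  ∣ ⁅ x ⁆ ∪ ⁅ y ⁆ ∪ ⁅ z ⁆ ∣                ≤⟨ ∣p∪q∣≤∣p∣+∣q∣ ⁅ x ⁆ (⁅ y ⁆ ∪ ⁅ z ⁆) ⟩
  ∣ ⁅ x ⁆ ∣ ℕ.+ ∣ ⁅ y ⁆ ∪ ⁅ z ⁆ ∣           ≤⟨ ℕ.+-monoʳ-≤ ∣ ⁅ x ⁆ ∣ (∣p∪q∣≤∣p∣+∣q∣ ⁅ y ⁆ ⁅ z ⁆) ⟩
  ∣ ⁅ x ⁆ ∣ ℕ.+ (∣ ⁅ y ⁆ ∣ ℕ.+ ∣ ⁅ z ⁆ ∣)   ≡⟨ cong₂ ℕ._+_ (∣⁅x⁆∣≡1 x) (cong₂ ℕ._+_ (∣⁅x⁆∣≡1 y) (∣⁅x⁆∣≡1 z)) ⟩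
  3                                       ∎
  where open ℕ.≤-Reasoning

toℕ-pred : ∀ {n} (s : Fin n) → toℕ (pred s) ≡ ℕ.pred (toℕ s)
toℕ-pred Fin.zero    = refl
toℕ-pred (Fin.suc s) = Fin.toℕ-inject₁ s

-- The last vertex is its own successor.
next : ∀ {n} → Fin n → Fin n
next {n} s with suc (toℕ s) ℕ.<? n
... | yes 1+s<n = fromℕ< 1+s<n
... | no _      = s

toℕ-next : ∀ {n} (s : Fin n) → suc (toℕ s) ℕ.< n → toℕ (next s) ≡ suc (toℕ s)
toℕ-next {n} s 1+s<n with suc (toℕ s) ℕ.<? n
... | yes 1+s<n′ = Fin.toℕ-fromℕ< 1+s<n′
... | no  1+s≮n  = contradiction 1+s<n 1+s≮n

path : ∀ {n} → Graph n
path s = ⁅ pred s ⁆ ∪ ⁅ next s ⁆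

path-closer : ∀ {n} (s t : Fin n) → s ≢ t →
  ∃ λ u → u ∈ path s × ∣ toℕ u - toℕ t ∣ ℕ.< ∣ toℕ s - toℕ t ∣
path-closer s t s≢t with ℕ.<-cmp (toℕ s) (toℕ t)
... | tri< s<t _ _ = next s , x∈p∪q⁺ (inj₂ (x∈⁅x⁆ (next s))) ,
  subst (λ m → ∣ m - toℕ t ∣ ℕ.< ∣ toℕ s - toℕ t ∣)
    (sym (toℕ-next s (ℕ.≤-<-trans s<t (Fin.toℕ<n t)))) (∣1+m-n∣<∣m-n∣ s<t)
... | tri≈ _ s≡t _ = contradiction (Fin.toℕ-injective s≡t) s≢t
... | tri> _ _ t<s = pred s , x∈p∪q⁺ (inj₁ (x∈⁅x⁆ (pred s))) ,
  subst (λ m → ∣ m - toℕ t ∣ ℕ.< ∣ toℕ s - toℕ t ∣)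
    (sym (toℕ-pred s)) (∣pred[m]-n∣<∣m-n∣ t<s)

module _ {n} (i* j* : Fin n) where

  Special : Fin n → Fin n → Set
  Special s t = (s ≡ i* × t ≡ j*) ⊎ (s ≡ j* × t ≡ i*)

  special? : ∀ s t → Dec (Special s t)
  special? s t = (s ≟ i* ×-dec t ≟ j*) ⊎-dec (s ≟ j* ×-dec t ≟ i*)

  partner : Fin n → Fin n
  partner s = if ⌊ s ≟ i* ⌋ then j* else i*

  partner-special : i* ≢ j* → ∀ {s t} → Special s t → partner s ≡ t
  partner-special _       (inj₁ (refl , refl)) =
    cong (if_then j* else i*) (⌊⌋≡true (i* ≟ i*) refl)
  partner-special i*≢j* (inj₂ (refl , refl)) =
    cong (if_then j* else i*) (⌊⌋≡false (j* ≟ i*) (λ j*≡i* → i*≢j* (sym j*≡i*)))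

  graph : Graph n
  graph s = ⁅ partner s ⁆ ∪ path s

  graph-maxOutDegree : MaxOutDegreeAtMost graph 3
  graph-maxOutDegree s = ∣⁅x⁆∪⁅y⁆∪⁅z⁆∣≤3 (partner s) (pred s) (next s)

-- dist n h i* j* s t is definitionally distCases ⌊ s ≟ t ⌋ (isSpecial s t) (r s t).
distCases : Bool → Bool → ℚ → ℚ
distCases b c r = if b then 0ℚ else if c then 1ℚ else 1ℚ + r

distCases-≤ : ∀ b c {r} → 0ℚ ℚ.≤ r → distCases b c r ℚ.≤ 1ℚ + r
distCases-≤ true  _     0≤r = ℚ.≤-trans (ℚ.nonNegative⁻¹ 1ℚ) (p≤p+q 1ℚ 0≤r)
distCases-≤ false true  0≤r = p≤p+q 1ℚ 0≤r
distCases-≤ false false _   = ℚ.≤-refl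

module _ (n : ℕ) (h : 2 ≤ n) (i* j* : Fin n) where

  private
    d = dist n h i* j*
    r : Fin n → Fin n → ℚ
    r s t = ratio n h ∣ toℕ s - toℕ t ∣
    isSpecial : Fin n → Fin n → Bool
    isSpecial s t = (⌊ s ≟ i* ⌋ ∧ ⌊ t ≟ j* ⌋) ∨ (⌊ s ≟ j* ⌋ ∧ ⌊ t ≟ i* ⌋)

  dist-self : ∀ t → d t t ≡ 0ℚ
  dist-self t = cong (λ b → distCases b (isSpecial t t) (r t t)) (⌊⌋≡true (t ≟ t) refl)

  dist-nonSpecial : ∀ {s t} → s ≢ t → ¬ Special i* j* s t → d s t ≡ 1ℚ + r s t
  dist-nonSpecial {s} {t} s≢t ¬sp =
    cong₂ (λ b c → distCases b c (r s t)) (⌊⌋≡false (s ≟ t) s≢t) not-special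
    where
    isYes∧isYes≗does : ∀ {a b} {A : Set a} {B : Set b} (a? : Dec A) (b? : Dec B) →
                       ⌊ a? ⌋ ∧ ⌊ b? ⌋ ≡ does a? ∧ does b?
    isYes∧isYes≗does a? b? = cong₂ _∧_ (isYes≗does a?) (isYes≗does b?)

    not-special : isSpecial s t ≡ false
    not-special = trans
      (cong₂ _∨_ (isYes∧isYes≗does (s ≟ i*) (t ≟ j*)) (isYes∧isYes≗does (s ≟ j*) (t ≟ i*)))
      (dec-false (special? i* j* s t) ¬sp)

  dist-≤ : ∀ u t → d u t ℚ.≤ 1ℚ + r u t
  dist-≤ u t = distCases-≤ ⌊ u ≟ t ⌋ (isSpecial u t) (ratio-nonNeg n h _)

  dist-pos⇒≢ : ∀ {s t} → 0ℚ < d s t → s ≢ t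
  dist-pos⇒≢ {s} 0<d refl = ℚ.<-irrefl refl (subst (0ℚ <_) (dist-self s) 0<d)

  nonSpecial-closer : ∀ {s t} → s ≢ t → ¬ Special i* j* s t →
    ∃ λ u → u ∈ path s × d u t < d s t
  nonSpecial-closer {s} {t} s≢t ¬sp with path-closer s t s≢t
  ... | u , u∈path , closer = u , u∈path , (begin-strict
    d u t          ≤⟨ dist-≤ u t ⟩
    1ℚ + r u t     <⟨ ℚ.+-monoʳ-< 1ℚ (ratio-mono-< n h closer) ⟩
    1ℚ + r s t     ≡⟨ dist-nonSpecial s≢t ¬sp ⟨
    d s t          ∎)
    where open ℚ.≤-Reasoning

  navigable : i* ≢ j* → Navigable d (graph i* j*)
  navigable i*≢j* s t 0<d with special? i* j* s t
  ... | yes sp = t ,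
    subst (_∈ graph i* j* s) (partner-special i* j* i*≢j* sp) (x∈p∪q⁺ (inj₁ (x∈⁅x⁆ _))) ,
    subst (_< d s t) (sym (dist-self t)) 0<d
  ... | no ¬sp with nonSpecial-closer (dist-pos⇒≢ 0<d) ¬sp
  ...   | u , u∈path , closer = u , x∈p∪q⁺ (inj₂ u∈path) , closer

lemma6p3 : (n : ℕ) (h : 2 ≤ n) (i* j* : Fin n) → i* ≢ j* →
    ∃ λ (E : Graph n) → Navigable (dist n h i* j*) E × MaxOutDegreeAtMost E 3
lemma6p3 n h i* j* i*≢j* =
  graph i* j* , navigable n h i* j* i*≢j* , graph-maxOutDegree i* j*
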